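{- Let $\mathcal G$ be a connected simple graph with vertex set $n=\{0,1,\ldots,n-1\}$, $n\ge 3$, having a vertex of degree $1$. Then $\mathcal G$ is not perm-complete. Consequently, no tree having three or more vertices is perm-complete.
   Context: Permutations in $\mathrm{Sym}(n)$ compose left to right. For a finite sequence $\mathbf s$ in $\mathrm{Sym}(n)$, $\bigcirc\mathbf s$ is the composite of its terms in order, $\mathrm{Seq}(\mathbf s)$ the set of its rearrangements and $\mathrm{Prod}(\mathbf s)=\{\bigcirc\mathbf r:\mathbf r\in\mathrm{Seq}(\mathbf s)\}$; $\mathbf s$ is perm-complete iff $\mathrm{Prod}(\mathbf s)$ is $\mathrm{Alt}(n)$ or $\mathrm{Sym}(n)\setminus\mathrm{Alt}(n)$. A simple graph on vertex set $n$ is perm-complete iff it is isomorphic to the graph whose edges are the terms of some perm-complete sequence $\mathbf u$ of pairwise distinct transpositions in $\mathrm{Sym}(n)$ (an edge $(x\,y)$ corresponding to the transposition $(x\,y)$). -}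

module Defs where

open import Data.Nat using (ℕ; _≥_)
open import Data.Nat.Divisibility using (_∣_)
open import Data.Fin using (Fin)
open import Data.Bool using (Bool; true; false)
open import Data.List using (List; []; _∷_; length)
open import Data.List.Relation.Unary.All using (All)
open import Data.List.Relation.Unary.Any using (Any)
open import Data.List.Relation.Unary.AllPairs using (AllPairs)
open import Data.List.Relation.Binary.Permutation.Propositional using (_↭_)
open import Data.Fin.Permutation using (Permutation′; _⟨$⟩ʳ_; _⟨$⟩ˡ_; _∘ₚ_; id; transpose; _≈_)
open import Data.Product using (Σ; ∃; _×_; _,_)
open import Data.Sum using (_⊎_)
open import Relation.Binary.PropositionalEquality using (_≡_; _≢_)
open import Relation.Binary.Construct.Closure.ReflexiveTransitive using (Star)
open import Relation.Nullary using (¬_)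
open import Function.Bundles using (_⇔_)

-- Permutations of the set n = Fin n (the elements of Sym(n)).
-- Equality of permutations is pointwise (_≈_ of Data.Fin.Permutation).
-- π ∘ₚ ρ applies π first, then ρ: composition left to right.

Perm : ℕ → Set
Perm n = Permutation′ n

○ : ∀ {n} → List (Perm n) → Perm n
○ []       = id
○ (t ∷ ts) = t ∘ₚ ○ ts

IsTransposition : ∀ {n} → Perm n → Set
IsTransposition {n} t = Σ (Fin n) λ x → Σ (Fin n) λ y → x ≢ y × t ≈ transpose x y

IsEven : ∀ {n} → Perm n → Set
IsEven {n} π = Σ (List (Perm n)) λ ts →
  All IsTransposition ts × 2 ∣ length ts × ○ ts ≈ π

InProd : ∀ {n} → List (Perm n) → Perm n → Set
InProd {n} s π = Σ (List (Perm n)) λ r → r ↭ s × ○ r ≈ π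

PermComplete : ∀ {n} → List (Perm n) → Set
PermComplete {n} s =
  ((π : Perm n) → InProd s π ⇔ IsEven π) ⊎
  ((π : Perm n) → InProd s π ⇔ (¬ IsEven π))

record SimpleGraph (n : ℕ) : Set where
  field
    adj     : Fin n → Fin n → Bool
    sym     : ∀ x y → adj x y ≡ adj y x
    irrefl  : ∀ x → adj x x ≡ false
open SimpleGraph public

Adj : ∀ {n} → SimpleGraph n → Fin n → Fin n → Set
Adj G x y = adj G x y ≡ true

-- edge relation of the graph whose edges are the terms of u:
-- {x,y} is an edge iff x ≠ y and (x y) is a term of u
EdgeOf : ∀ {n} → List (Perm n) → Fin n → Fin n → Set
EdgeOf u x y = x ≢ y × Any (λ t → t ≈ transpose x y) u

IsoToEdges : ∀ {n} → SimpleGraph n → (Fin n → Fin n → Set) → Set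
IsoToEdges {n} G E = Σ (Perm n) λ f →
  (x y : Fin n) → Adj G x y ⇔ E (f ⟨$⟩ʳ x) (f ⟨$⟩ʳ y)

PermCompleteGraph : ∀ {n} → SimpleGraph n → Set
PermCompleteGraph {n} G = Σ (List (Perm n)) λ u →
  All IsTransposition u ×
  AllPairs (λ s t → ¬ (s ≈ t)) u ×
  PermComplete u ×
  IsoToEdges G (EdgeOf u)

Connected : ∀ {n} → SimpleGraph n → Set
Connected {n} G = (x y : Fin n) → Star (Adj G) x y

HasDegreeOne : ∀ {n} → SimpleGraph n → Fin n → Set
HasDegreeOne {n} G v = Σ (Fin n) λ w → Adj G v w × ((w′ : Fin n) → Adj G v w′ → w′ ≡ w)

-- Tree: connected, and minimally so (acyclic): removing any edge {x,y}
-- disconnects x from y.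
WithoutEdge : ∀ {n} → SimpleGraph n → Fin n → Fin n → Fin n → Fin n → Set
WithoutEdge G x y a b = Adj G a b × ¬ ((a ≡ x × b ≡ y) ⊎ (a ≡ y × b ≡ x))

IsTree : ∀ {n} → SimpleGraph n → Set
IsTree {n} G = Connected G ×
  ((x y : Fin n) → Adj G x y → ¬ Star (WithoutEdge G x y) x y)

module Submission where

-- Let v be a leaf of G, with unique neighbour w, and let u be a sequence of
-- distinct transpositions whose graph is isomorphic to G, the leaf v going to
-- v′.  Exactly one term of u, namely (v′ w′), moves v′; since this count is
-- invariant under rearrangement, every product of a rearrangement of u moves
-- v′.  This is incompatible with perm-completeness when n ≥ 3:
--   * if Prod(u) = Alt(n), then id ∈ Prod(u), and id fixes v′;
--   * if Prod(u) = Sym(n) ∖ Alt(n), then ○ u is odd, and following it by two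
--     suitable transpositions yields an odd permutation fixing v′.
-- For trees it remains to find a leaf.  If no vertex were a leaf, every vertex
-- would have, for every p, a neighbour other than p, so there would be an
-- infinite walk that never turns straight back.  In an acyclic graph such a
-- walk never repeats a vertex (a repetition closes a cycle through the last
-- edge), which contradicts the pigeonhole principle.

open import Defs hiding (sym)
open import Data.Nat using (ℕ; _≥_)
open import Data.Fin using (Fin)
open import Data.Product using (Σ; _×_)
open import Relation.Nullary using (¬_)

open import Data.Nat using (zero; suc; _≤_; _<_; _≤′_; ≤′-refl; ≤′-step; s≤s)
open import Data.Nat.Properties
  using ( n<1+n; ≤-refl; <⇒≤; <-irrefl; n≤0⇒n≡0; m<n⇒m<1+n; m≤n⇒m<n∨m≡n; m<1+n⇒m≤n
        ; ≤⇒≤′; suc-injective)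
open import Data.Nat.Divisibility using (_∣_; _∣0; ∣-refl; ∣m∣n⇒∣m+n)
open import Data.Fin using (toℕ; punchIn; punchOut)
open import Data.Fin.Patterns using (0F)
open import Data.Fin.Properties
  using ( _≟_; any?; all?; ¬∀⟶∃¬; pigeonhole; toℕ≤pred[n]
        ; punchInᵢ≢i; punchIn-injective; punchIn-punchOut)
open import Data.Fin.Permutation
  using (_⟨$⟩ʳ_; _⟨$⟩ˡ_; _∘ₚ_; transpose; id; _≈_; inverseˡ; inverseʳ)
open import Data.Fin.Permutation.Components using (transpose-inverse)
import Data.Bool.Properties as Bool
open import Data.List using (List; []; _∷_; _++_; length; filter)
open import Data.List.Properties using (length-++; filter-none)
open import Data.List.Membership.Propositional using (_∈_)
open import Data.List.Relation.Unary.All as All using (All; []; _∷_)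
open import Data.List.Relation.Unary.All.Properties using (++⁺; All¬⇒¬Any)
open import Data.List.Relation.Unary.Any as Any using (Any; here; there)
open import Data.List.Relation.Unary.AllPairs using (AllPairs; _∷_)
open import Data.List.Relation.Binary.Permutation.Propositional using (_↭_; ↭-refl)
open import Data.List.Relation.Binary.Permutation.Propositional.Properties using (↭-length; filter-↭)
open import Data.Product using (_,_; proj₁; proj₂)
open import Data.Sum using (_⊎_; inj₁; inj₂)
open import Data.Empty using (⊥)
open import Function using (_∘_)
open import Function.Bundles using (_⇔_; Equivalence)
open import Relation.Nullary using (yes; no; Dec)
open import Relation.Nullary.Negation using (contradiction)
open import Relation.Nullary.Decidable using (_×-dec_; ¬?)
open import Relation.Unary using (Decidable)
open import Relation.Binary.PropositionalEquality
  using (_≡_; _≢_; refl; sym; trans; cong; subst; module ≡-Reasoning)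
open import Relation.Binary.Construct.Closure.ReflexiveTransitive using (Star; ε; _◅_)
open Equivalence using (to; from)

private
  variable
    n m : ℕ

transpose-sends : (i j : Fin n) → transpose i j ⟨$⟩ʳ i ≡ j
transpose-sends i j with i ≟ i
... | yes _  = refl
... | no i≢i = contradiction refl i≢i

transpose-sends-back : (i j : Fin n) → transpose i j ⟨$⟩ʳ j ≡ i
transpose-sends-back i j with j ≟ i
... | yes j≡i = j≡i
... | no _ with j ≟ j
...   | yes _  = refl
...   | no j≢j = contradiction refl j≢j

transpose-moves : (i j k : Fin n) → transpose i j ⟨$⟩ʳ k ≢ k → k ≡ i ⊎ k ≡ j
transpose-moves i j k moved with k ≟ i
... | yes k≡i = inj₁ k≡i
... | no _ with k ≟ j
...   | yes k≡j = inj₂ k≡j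
...   | no _    = contradiction refl moved

transpose-fixes : (i j k : Fin n) → k ≢ i → k ≢ j → transpose i j ⟨$⟩ʳ k ≡ k
transpose-fixes i j k k≢i k≢j with k ≟ i
... | yes k≡i = contradiction k≡i k≢i
... | no _ with k ≟ j
...   | yes k≡j = contradiction k≡j k≢j
...   | no _    = refl

transpose-comm : (i j : Fin n) → transpose i j ≈ transpose j i
transpose-comm i j k with i ≟ k | j ≟ k
... | yes refl | _        = trans (transpose-sends k j) (sym (transpose-sends-back j k))
... | no _     | yes refl = trans (transpose-sends-back i k) (sym (transpose-sends k i))
... | no i≢k   | no j≢k   =
  trans (transpose-fixes i j k (i≢k ∘ sym) (j≢k ∘ sym))
        (sym (transpose-fixes j i k (j≢k ∘ sym) (i≢k ∘ sym)))

isTransposition : {i j : Fin n} → i ≢ j → IsTransposition (transpose i j)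
isTransposition i≢j = _ , _ , i≢j , λ _ → refl

permutation-injective : (π : Perm n) {a b : Fin n} → π ⟨$⟩ʳ a ≡ π ⟨$⟩ʳ b → a ≡ b
permutation-injective π {a} {b} πa≡πb =
  trans (sym (inverseˡ π)) (trans (cong (π ⟨$⟩ˡ_) πa≡πb) (inverseˡ π))

○-++ : (r s : List (Perm n)) → ○ (r ++ s) ≈ ○ r ∘ₚ ○ s
○-++ []      s k = refl
○-++ (t ∷ r) s k = ○-++ r s (t ⟨$⟩ʳ k)

-- Cancelling two transpositions (by appending their inverses) keeps
-- a permutation even.
even-cancel : {π : Perm n} {a b c d : Fin n} → a ≢ b → c ≢ d →
              IsEven (π ∘ₚ transpose a b ∘ₚ transpose c d) → IsEven π
even-cancel {π = π} {a} {b} {c} {d} a≢b c≢d (ts , ts-tr , 2∣ts , ○ts≈) =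
  ts ++ τ , ++⁺ ts-tr (isTransposition (c≢d ∘ sym) ∷ isTransposition (a≢b ∘ sym) ∷ []) ,
  subst (2 ∣_) (sym (length-++ ts)) (∣m∣n⇒∣m+n 2∣ts ∣-refl) , undo
  where
  open ≡-Reasoning
  τ : List (Perm _)
  τ = transpose d c ∷ transpose b a ∷ []
  undo : ○ (ts ++ τ) ≈ π
  undo k = begin
    ○ (ts ++ τ) ⟨$⟩ʳ k
      ≡⟨ ○-++ ts τ k ⟩
    transpose b a ⟨$⟩ʳ (transpose d c ⟨$⟩ʳ (○ ts ⟨$⟩ʳ k))
      ≡⟨ cong (λ z → transpose b a ⟨$⟩ʳ (transpose d c ⟨$⟩ʳ z)) (○ts≈ k) ⟩
    transpose b a ⟨$⟩ʳ (transpose d c ⟨$⟩ʳ (transpose c d ⟨$⟩ʳ (transpose a b ⟨$⟩ʳ (π ⟨$⟩ʳ k))))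
      ≡⟨ cong (transpose b a ⟨$⟩ʳ_) (transpose-inverse d c {transpose a b ⟨$⟩ʳ (π ⟨$⟩ʳ k)}) ⟩
    transpose b a ⟨$⟩ʳ (transpose a b ⟨$⟩ʳ (π ⟨$⟩ʳ k))
      ≡⟨ transpose-inverse b a ⟩
    π ⟨$⟩ʳ k
      ∎

third-point : n ≥ 3 → (a b : Fin n) → Σ (Fin n) λ d → d ≢ a × d ≢ b
third-point {suc zero}       (s≤s ())
third-point {suc (suc zero)} (s≤s (s≤s ()))
third-point {suc (suc (suc _))} _ a b with a ≟ b
... | yes refl = punchIn a 0F , punchInᵢ≢i a 0F , punchInᵢ≢i a 0F
... | no a≢b   = punchIn a (punchIn b′ 0F) , punchInᵢ≢i a _ , avoids-b
  where
  b′ = punchOut a≢b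
  avoids-b : punchIn a (punchIn b′ 0F) ≢ b
  avoids-b eq = punchInᵢ≢i b′ 0F (punchIn-injective a _ _ (trans eq (sym (punchIn-punchOut a≢b))))

-- If odd permutations exist and n ≥ 3, then some odd permutation fixes any
-- given point v: follow an odd σ by (c d)(d v), where c = σ v.
odd-fixing : n ≥ 3 → (σ : Perm n) → ¬ IsEven σ → (v : Fin n) →
             Σ (Perm n) λ π → ¬ IsEven π × π ⟨$⟩ʳ v ≡ v
odd-fixing n≥3 σ σ-odd v with third-point n≥3 (σ ⟨$⟩ʳ v) v
... | d , d≢c , d≢v =
  σ ∘ₚ transpose c d ∘ₚ transpose d v ,
  σ-odd ∘ even-cancel {π = σ} (d≢c ∘ sym) d≢v ,
  trans (cong (transpose d v ⟨$⟩ʳ_) (transpose-sends c d)) (transpose-sends d v)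
  where c = σ ⟨$⟩ʳ v

-- If every product of a rearrangement of u moves v, u is not perm-complete:
-- Alt(n) contains id, and Sym(n) ∖ Alt(n) contains an element fixing v.
always-moved⇒¬perm-complete : n ≥ 3 → (u : List (Perm n)) (v : Fin n) →
  ((π : Perm n) → InProd u π → π ⟨$⟩ʳ v ≢ v) → ¬ PermComplete u
always-moved⇒¬perm-complete n≥3 u v moved (inj₁ prod-even) =
  moved id (from (prod-even id) ([] , [] , 2 ∣0 , λ _ → refl)) refl
always-moved⇒¬perm-complete n≥3 u v moved (inj₂ prod-odd)
  with odd-fixing n≥3 (○ u) (to (prod-odd (○ u)) (u , ↭-refl , λ _ → refl)) v
... | π , π-odd , π-fixes = moved π (from (prod-odd π) π-odd) π-fixes

Moves : Fin n → Perm n → Set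
Moves v π = π ⟨$⟩ʳ v ≢ v

moves? : (v : Fin n) → Decidable (Moves v)
moves? v π = ¬? (π ⟨$⟩ʳ v ≟ v)

moverCount : Fin n → List (Perm n) → ℕ
moverCount v r = length (filter (moves? v) r)

moverCount-↭ : {v : Fin n} {r s : List (Perm n)} → r ↭ s → moverCount v r ≡ moverCount v s
moverCount-↭ {v = v} r↭s = ↭-length (filter-↭ (moves? v) r↭s)

-- Without movers of v, the composite fixes v (a moving first term would
-- make the count positive, so only the fixing case arises).
fixed-without-movers : (v : Fin n) (r : List (Perm n)) → moverCount v r ≡ 0 → ○ r ⟨$⟩ʳ v ≡ v
fixed-without-movers v []      _ = refl
fixed-without-movers v (t ∷ r) none with t ⟨$⟩ʳ v ≟ v
... | yes t-fixes = trans (cong (○ r ⟨$⟩ʳ_) t-fixes) (fixed-without-movers v r none)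

moved-by-sole-mover : (v : Fin n) (r : List (Perm n)) → moverCount v r ≡ 1 → Moves v (○ r)
moved-by-sole-mover v (t ∷ r) one with t ⟨$⟩ʳ v ≟ v
... | yes t-fixes = moved-by-sole-mover v r one ∘ trans (cong (○ r ⟨$⟩ʳ_) (sym t-fixes))
... | no t-moves  = λ fixes → t-moves (permutation-injective (○ r)
                      (trans fixes (sym (fixed-without-movers v r (suc-injective one)))))

sole-mover : {v : Fin n} {T : Perm n} (u : List (Perm n)) → Moves v T → Any (_≈ T) u →
             All (λ t → Moves v t → t ≈ T) u → AllPairs (λ s t → ¬ s ≈ t) u →
             moverCount v u ≡ 1
sole-mover {v = v} {T} (t ∷ u) T-moves T∈u (t-mover ∷ movers) (t≉ ∷ distinct)
  with t ⟨$⟩ʳ v ≟ v | T∈u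
... | yes t-fixes | here t≈T   = contradiction (trans (sym (t≈T v)) t-fixes) T-moves
... | yes _       | there T∈u′ = sole-mover {v = v} {T} u T-moves T∈u′ movers distinct
... | no t-moves  | here t≈T   =
  cong suc (cong length (filter-none (moves? v) (All.zipWith (λ {s} → no-mover {s}) (movers , t≉))))
  where
  -- the later terms differ from t ≈ T, so none of them moves v
  no-mover : ∀ {s} → (Moves v s → s ≈ T) × ¬ t ≈ s → ¬ Moves v s
  no-mover (s-mover , t≉s) s-moves = t≉s (λ k → trans (t≈T k) (sym (s-mover s-moves k)))
... | no t-moves  | there T∈u′ =
  -- t moves v, so t ≈ T, but T occurs again later
  contradiction T∈u′
    (All¬⇒¬Any (All.map (λ t≉s s≈T → t≉s (λ k → trans (t-mover t-moves k) (sym (s≈T k)))) t≉))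

leaf-image : {E : Fin n → Fin n → Set} (G : SimpleGraph n) (f : Perm n) →
             ((x y : Fin n) → Adj G x y ⇔ E (f ⟨$⟩ʳ x) (f ⟨$⟩ʳ y)) →
             {v : Fin n} → HasDegreeOne G v →
             Σ (Fin n) λ w → E (f ⟨$⟩ʳ v) w × ((y : Fin n) → E (f ⟨$⟩ʳ v) y → y ≡ w)
leaf-image {E = E} G f iso {v} (w , vw , only-w) = f ⟨$⟩ʳ w , to (iso v w) vw , only-fw
  where
  only-fw : (y : Fin _) → E (f ⟨$⟩ʳ v) y → y ≡ f ⟨$⟩ʳ w
  only-fw y e = trans (sym (inverseʳ f)) (cong (f ⟨$⟩ʳ_) (only-w (f ⟨$⟩ˡ y)
                  (from (iso v (f ⟨$⟩ˡ y)) (subst (E (f ⟨$⟩ʳ v)) (sym (inverseʳ f)) e))))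

term-edge : {u : List (Perm n)} {t : Perm n} {x y : Fin n} →
            t ∈ u → t ≈ transpose x y → x ≢ y → EdgeOf u x y
term-edge t∈u t≈xy x≢y = x≢y , Any.map (λ { refl → t≈xy }) t∈u

leaf-mover : {u : List (Perm n)} {v w : Fin n} → ((y : Fin n) → EdgeOf u v y → y ≡ w) →
             {t : Perm n} → t ∈ u → IsTransposition t → Moves v t → t ≈ transpose v w
leaf-mover {v = v} only-w {t} t∈u (x , y , x≢y , t≈xy) t-moves
  with transpose-moves x y v (t-moves ∘ trans (t≈xy v))
... | inj₁ refl = subst (λ z → t ≈ transpose v z) (only-w y (term-edge t∈u t≈xy x≢y)) t≈xy
... | inj₂ refl =
  subst (λ z → t ≈ transpose v z) (only-w x (term-edge t∈u t≈vx (x≢y ∘ sym))) t≈vx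
  where
  t≈vx : t ≈ transpose v x
  t≈vx k = trans (t≈xy k) (transpose-comm x v k)

leaf-sole-mover : {u : List (Perm n)} {v w : Fin n} →
                  All IsTransposition u → AllPairs (λ s t → ¬ s ≈ t) u →
                  EdgeOf u v w → ((y : Fin n) → EdgeOf u v y → y ≡ w) → moverCount v u ≡ 1
leaf-sole-mover {u = u} {v} {w} u-tr u-distinct (v≢w , vw∈u) only-w =
  sole-mover {v = v} {transpose v w} u vw-moves vw∈u
    (All.tabulate (λ t∈u → leaf-mover only-w t∈u (All.lookup u-tr t∈u))) u-distinct
  where
  vw-moves : Moves v (transpose v w)
  vw-moves fixes = v≢w (sym (trans (sym (transpose-sends v w)) fixes))

leaf⇒¬perm-complete : n ≥ 3 → (G : SimpleGraph n) → Σ (Fin n) (HasDegreeOne G) →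
                      ¬ PermCompleteGraph G
leaf⇒¬perm-complete n≥3 G (v , leaf) (u , u-tr , u-distinct , u-complete , f , iso)
  with leaf-image {E = EdgeOf u} G f iso leaf
... | w′ , e , only-w′ = always-moved⇒¬perm-complete n≥3 u (f ⟨$⟩ʳ v) always-moved u-complete
  where
  always-moved : (π : Perm _) → InProd u π → Moves (f ⟨$⟩ʳ v) π
  always-moved π (r , r↭u , ○r≈π) =
    moved-by-sole-mover (f ⟨$⟩ʳ v) r
      (trans (moverCount-↭ r↭u) (leaf-sole-mover u-tr u-distinct e only-w′))
    ∘ trans (○r≈π (f ⟨$⟩ʳ v))

Acyclic : SimpleGraph n → Set
Acyclic {n} G = (x y : Fin n) → Adj G x y → ¬ Star (WithoutEdge G x y) x y

Branching : SimpleGraph n → Set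
Branching {n} G = (x p : Fin n) → Σ (Fin n) λ y → Adj G x y × y ≢ p

record NonBacktrackingWalk (G : SimpleGraph n) : Set where
  field
    vertex    : ℕ → Fin n
    step      : (k : ℕ) → Adj G (vertex k) (vertex (suc k))
    no-return : (k : ℕ) → vertex (suc (suc k)) ≢ vertex k

DistinctUpTo : {A : Set} → (ℕ → A) → ℕ → Set
DistinctUpTo X m = ∀ {a b} → a ≤ m → b ≤ m → X a ≡ X b → a ≡ b

distinct-extend : {A : Set} {X : ℕ → A} → DistinctUpTo X m →
                  ((i : ℕ) → i ≤ m → X i ≢ X (suc m)) → DistinctUpTo X (suc m)
distinct-extend distinct new a≤ b≤ Xa≡Xb with m≤n⇒m<n∨m≡n a≤ | m≤n⇒m<n∨m≡n b≤
... | inj₁ a<    | inj₁ b<    = distinct (m<1+n⇒m≤n a<) (m<1+n⇒m≤n b<) Xa≡Xb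
... | inj₁ a<    | inj₂ refl  = contradiction Xa≡Xb (new _ (m<1+n⇒m≤n a<))
... | inj₂ refl  | inj₁ b<    = contradiction (sym Xa≡Xb) (new _ (m<1+n⇒m≤n b<))
... | inj₂ refl  | inj₂ refl  = refl

path-back : {A : Set} {R : A → A → Set} (X : ℕ → A) {i m : ℕ} →
            ((k : ℕ) → k < m → R (X (suc k)) (X k)) → i ≤′ m → Star R (X m) (X i)
path-back X back ≤′-refl             = ε
path-back X back (≤′-step {m} i≤′m) =
  back m (n<1+n m) ◅ path-back X (λ k k<m → back k (m<n⇒m<1+n k<m)) i≤′m

module _ {G : SimpleGraph n} (acyclic : Acyclic G) (W : NonBacktrackingWalk G) where
  open NonBacktrackingWalk W

  avoids-last-edge : DistinctUpTo vertex m → (k : ℕ) → k < m →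
                     WithoutEdge G (vertex m) (vertex (suc m)) (vertex (suc k)) (vertex k)
  avoids-last-edge distinct k k<m = trans (SimpleGraph.sym G _ _) (step k) , same-edge
    where
    same-edge : ¬ ((vertex (suc k) ≡ vertex _ × vertex k ≡ vertex (suc _))
                   ⊎ (vertex (suc k) ≡ vertex (suc _) × vertex k ≡ vertex _))
    same-edge (inj₁ (k+1~m , k~m+1)) =
      no-return k (trans (cong (vertex ∘ suc) (distinct k<m ≤-refl k+1~m)) (sym k~m+1))
    same-edge (inj₂ (_ , k~m)) = <-irrefl (distinct (<⇒≤ k<m) ≤-refl k~m) k<m

  -- Returning at step m + 1 to an earlier vertex would close a cycle through
  -- the last edge.
  fresh-vertex : DistinctUpTo vertex m → (i : ℕ) → i ≤ m → vertex i ≢ vertex (suc m)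
  fresh-vertex {m} distinct i i≤m returns =
    acyclic (vertex m) (vertex (suc m)) (step m)
      (subst (Star _ (vertex m)) returns (path-back vertex (avoids-last-edge distinct) (≤⇒≤′ i≤m)))

  distinct-up-to : (m : ℕ) → DistinctUpTo vertex m
  distinct-up-to zero    a≤0 b≤0 _ = trans (n≤0⇒n≡0 a≤0) (sym (n≤0⇒n≡0 b≤0))
  distinct-up-to (suc m) = distinct-extend (distinct-up-to m) (fresh-vertex (distinct-up-to m))

  -- By pigeonhole the first n + 1 vertices of the walk are not distinct.
  acyclic⇒no-walk : ⊥
  acyclic⇒no-walk with pigeonhole (n<1+n _) (λ i → vertex (toℕ i))
  ... | i , j , i<j , same = <-irrefl (distinct-up-to _ (toℕ≤pred[n] i) (toℕ≤pred[n] j) same) i<j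

branching-walk : {G : SimpleGraph n} → Branching G → Fin n → NonBacktrackingWalk G
branching-walk {n} branch x = record
  { vertex    = proj₂ ∘ states
  ; step      = λ k → proj₁ (proj₂ (branch (proj₂ (states k)) (proj₁ (states k))))
  ; no-return = λ k → proj₂ (proj₂ (branch (proj₂ (states (suc k))) (proj₁ (states (suc k)))))
  }
  where
  -- states k = (previous vertex, current vertex)
  states : ℕ → Fin n × Fin n
  states zero    = x , x
  states (suc k) = proj₂ (states k) , proj₁ (branch (proj₂ (states k)) (proj₁ (states k)))

other-neighbour? : (G : SimpleGraph n) (x p : Fin n) → Dec (Σ (Fin n) λ y → Adj G x y × y ≢ p)
other-neighbour? G x p = any? (λ y → (adj G x y Bool.≟ _) ×-dec ¬? (y ≟ p))

acyclic⇒stuck-vertex : {G : SimpleGraph n} → Acyclic G → Fin n →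
  Σ (Fin n) λ x → Σ (Fin n) λ p → ¬ Σ (Fin n) λ y → Adj G x y × y ≢ p
acyclic⇒stuck-vertex {n} {G} acyclic x₀ =
  let x , not-all = ¬∀⟶∃¬ n _ (λ x → all? (other-neighbour? G x)) not-branching
  in  x , ¬∀⟶∃¬ n _ (other-neighbour? G x) not-all
  where
  not-branching : ¬ Branching G
  not-branching branch = acyclic⇒no-walk acyclic (branching-walk {G = G} branch x₀)

connected⇒neighbour : {G : SimpleGraph n} → n ≥ 2 → Connected G →
                      (x : Fin n) → Σ (Fin n) (Adj G x)
connected⇒neighbour {suc zero} (s≤s ())
connected⇒neighbour {suc (suc _)} {G} _ connected x =
  first-step (punchInᵢ≢i x 0F ∘ sym) (connected x (punchIn x 0F))
  where
  first-step : ∀ {a b} → a ≢ b → Star (Adj G) a b → Σ (Fin _) (Adj G a)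
  first-step a≢a ε     = contradiction refl a≢a
  first-step _   (e ◅ _) = _ , e

stuck⇒leaf : {G : SimpleGraph n} {x p : Fin n} → Σ (Fin n) (Adj G x) →
             ¬ (Σ (Fin n) λ y → Adj G x y × y ≢ p) → HasDegreeOne G x
stuck⇒leaf {G = G} {x} {p} (y , xy) none = p , subst (Adj G x) (only-p y xy) xy , only-p
  where
  only-p : (w : Fin _) → Adj G x w → w ≡ p
  only-p w xw with w ≟ p
  ... | yes w≡p = w≡p
  ... | no w≢p  = contradiction (w , xw , w≢p) none

tree⇒leaf : {G : SimpleGraph n} → n ≥ 2 → IsTree G → Σ (Fin n) (HasDegreeOne G)
tree⇒leaf {suc zero} (s≤s ())
tree⇒leaf {suc (suc _)} {G} n≥2 (connected , acyclic) with acyclic⇒stuck-vertex {G = G} acyclic 0F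
... | x , p , none = x , stuck⇒leaf {G = G} (connected⇒neighbour {G = G} n≥2 connected x) none

theorem2p2 : ((n : ℕ) → n ≥ 3 → (G : SimpleGraph n) → Connected G →
                  Σ (Fin n) (HasDegreeOne G) → ¬ PermCompleteGraph G)
               × ((n : ℕ) → n ≥ 3 → (G : SimpleGraph n) → IsTree G → ¬ PermCompleteGraph G)
theorem2p2 = leaf-case , tree-case
  where
  leaf-case : (n : ℕ) → n ≥ 3 → (G : SimpleGraph n) → Connected G →
              Σ (Fin n) (HasDegreeOne G) → ¬ PermCompleteGraph G
  leaf-case n n≥3 G _ = leaf⇒¬perm-complete n≥3 G

  tree-case : (n : ℕ) → n ≥ 3 → (G : SimpleGraph n) → IsTree G → ¬ PermCompleteGraph G
  tree-case n n≥3 G tree = leaf⇒¬perm-complete n≥3 G (tree⇒leaf {G = G} (<⇒≤ n≥3) tree)
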